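{- Let $0<\varepsilon\le1$, let $\mathcal S=(S_1,\ldots,S_k)$ be a $(1+\varepsilon)$-increasing non-empty $k$-partition, and let $I_1,I_2\subseteq\{1,\ldots,k\}$ be two subsets, each of size exactly $k/2$, with $|I_1\triangle I_2|>k/30$. Then for every permutation $\pi$ of $\Omega=\bigcup_{i=1}^k S_i$, $d_{\mathrm{TV}}(\mu_{\mathcal S,I_1},\pi\mu_{\mathcal S,I_2})>\frac{1}{120}\varepsilon$.
   Context: A $k$-tuple $\mathcal S=(S_1,\ldots,S_k)$ is a non-empty $k$-partition if $S_1,\ldots,S_k$ are non-empty and pairwise disjoint; it is $\rho$-increasing if $|S_i|\ge\rho|S_{i-1}|$ for every $2\le i\le k$. For a non-empty $I\subseteq\{1,\ldots,k\}$, the chunk distribution $\mu_{\mathcal S,I}$ over $\Omega=\bigcup_i S_i$ is given by $\mu_{\mathcal S,I}(j)=\frac{1}{|I|\cdot|S_i|}$ for $i\in I$ and $j\in S_i$, and $\mu_{\mathcal S,I}(j)=0$ for $j\notin\bigcup_{i\in I}S_i$. For a permutation $\pi$ of $\Omega$, $\pi\mu$ denotes $x\mapsto\mu(\pi(x))$. $d_{\mathrm{TV}}(\mu,\nu)=\frac12\sum_x|\mu(x)-\nu(x)|$.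
   Formalization: The parameter ε ranges over the rationals in (0,1]. -}

module Defs where

open import Data.Nat using (ℕ; zero; suc)
import Data.Nat
open import Data.Fin using (Fin; zero; suc; toℕ)
open import Data.Fin.Subset using (Subset; _∈_; ∣_∣; Nonempty; _∪_; _─_)
open import Data.Fin.Subset.Properties using (_∈?_)
open import Data.Fin.Permutation using (Permutation′; _⟨$⟩ʳ_)
open import Data.Integer using (+_)
open import Data.Rational using (ℚ; 0ℚ; 1ℚ; _+_; _*_; _-_; _/_; _≤_; ½) renaming (∣_∣ to abs)
open import Data.Product using (∃; _×_)
open import Data.Empty using (⊥)
open import Relation.Nullary using (does)
open import Relation.Binary.PropositionalEquality using (_≡_; _≢_)
open import Data.Bool using (if_then_else_)

ℕ→ℚ : ℕ → ℚ
ℕ→ℚ m = + m / 1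

-- 1/m for m ≠ 0; 0 for m = 0 (never used with m = 0 under the hypotheses)
inv : ℕ → ℚ
inv zero = 0ℚ
inv (suc m) = + 1 / suc m

Σ : (k : ℕ) → (Fin k → ℚ) → ℚ
Σ zero f = 0ℚ
Σ (suc k) f = f zero + Σ k (λ i → f (suc i))

-- S : Fin k → Subset n is a non-empty k-partition of Ω = Fin n = ⋃ S_i
record IsNonEmptyPartition {k n : ℕ} (S : Fin k → Subset n) : Set where
  field
    nonempty : ∀ i → Nonempty (S i)
    disjoint : ∀ i j → i ≢ j → ∀ x → x ∈ S i → x ∈ S j → ⊥
    covers   : ∀ (x : Fin n) → ∃ λ i → x ∈ S i

IsIncreasing : {k n : ℕ} → ℚ → (Fin k → Subset n) → Set
IsIncreasing {k} ρ S = ∀ (i j : Fin k) → toℕ j ≡ suc (toℕ i) →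
  ρ * ℕ→ℚ ∣ S i ∣ ≤ ℕ→ℚ ∣ S j ∣

-- chunk distribution μ_{S,I}(x) = 1/(|I| |S_i|) if x ∈ S_i with i ∈ I, else 0
-- (written as a sum over i ∈ I; by disjointness at most one term is nonzero)
chunk : {k n : ℕ} → (Fin k → Subset n) → Subset k → Fin n → ℚ
chunk {k} S I x =
  Σ k (λ i → if does (i ∈? I)
               then (if does (x ∈? S i) then inv (∣ I ∣ Data.Nat.* ∣ S i ∣) else 0ℚ)
               else 0ℚ)

permDist : {n : ℕ} → Permutation′ n → (Fin n → ℚ) → Fin n → ℚ
permDist π μ x = μ (π ⟨$⟩ʳ x)

dTV : {n : ℕ} → (Fin n → ℚ) → (Fin n → ℚ) → ℚ
dTV {n} μ ν = ½ * Σ n (λ x → abs (μ x - ν x))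

_△_ : {k : ℕ} → Subset k → Subset k → Subset k
A △ B = (A ─ B) ∪ (B ─ A)

{-# OPTIONS --safe #-}
-- Let m = |I₁| = |I₂| and γ = ε/4, and give block i the weight w i = -γ if i ∈ I₂ ∖ I₁ and γ otherwise.
-- The test functions f = (w ∘ block) μ₁ and g = (w ∘ block) μ₂ satisfy Σ f - Σ g = γ |I₁ △ I₂| / m,
-- and f x - g y ≤ |μ₁ x - μ₂ y| for all points x, y. The only nontrivial case is x ∈ S_c with c ∈ I₁
-- and y ∈ S_d with d ∈ I₂ ∖ I₁: then c ≠ d, so by (1 + ε)-growth the densities 1/(m|S_c|) and
-- 1/(m|S_d|) differ by a factor of at least 1 + ε, which is exactly what γ (a + b) ≤ |a - b| needs.
-- Pairing x with y = π x and summing gives Σ |μ₁ - π μ₂| ≥ γ |I₁ △ I₂| / m, and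
-- |I₁ △ I₂| > k/30 = m/15 turns this into d_TV > ε/120.
module Submission where

open import Defs
open import Data.Fin using (Fin; zero; suc; toℕ)
open import Data.Fin.Subset using (Subset; inside; outside; ∣_∣; _∈_; _∉_)
open import Data.Fin.Subset.Properties using (_∈?_)
open import Data.Fin.Permutation using (Permutation′; _⟨$⟩ʳ_)
open import Relation.Binary.PropositionalEquality

-- A separate scope for the rational arithmetic: the statement at the end uses ℕ's _*_ unqualified.
module _ where
  open import Algebra.Bundles using (Ring)
  import Algebra.Properties.Semiring.Sum as SemiringSum
  open import Data.Bool using (true; false; if_then_else_; _xor_)
  open import Data.Empty using (⊥-elim)
  open import Data.Fin using (fromℕ<)
  import Data.Fin.Properties as Fin
  import Data.Fin.Subset.Properties as Subset
  open import Data.Integer as ℤ using (+_)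
  import Data.Integer.Properties as ℤ
  import Data.Integer.Tactic.RingSolver as ℤSolver
  open import Data.Nat as ℕ using (ℕ; zero; suc)
  import Data.Nat.Properties as ℕ
  import Data.Nat.Tactic.RingSolver as ℕSolver
  open import Data.Product using (_,_; proj₁; proj₂)
  open import Data.Rational renaming (∣_∣ to abs)
  open import Data.Rational.Properties
  open import Data.Rational.Solver using (module +-*-Solver)
  import Data.Rational.Unnormalised as ℚᵘ
  import Data.Rational.Unnormalised.Properties as ℚᵘ
  open import Data.Sum using (inj₁; inj₂)
  open import Data.Vec using (_∷_; [])
  open import Function using (_∘_)
  open import Relation.Binary.Definitions using (tri<; tri≈; tri>)
  open import Relation.Nullary using (does; yes; no)
  open import Relation.Nullary.Decidable using (dec-true; dec-false)

  open +-*-Solver using (_:+_; _:*_; _:-_; :-_; _:=_; con; solve)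
  open SemiringSum (Ring.semiring +-*-ring) using (sum; ∑-comm; ∑-permute)

  p≤q⇒0≤q-p : ∀ {p q} → p ≤ q → 0ℚ ≤ q - p
  p≤q⇒0≤q-p {p} {q} p≤q = begin
    0ℚ     ≡⟨ +-inverseʳ p ⟨
    p - p  ≤⟨ +-monoˡ-≤ (- p) p≤q ⟩
    q - p  ∎
    where open ≤-Reasoning

  0≤q-p⇒p≤q : ∀ {p q} → 0ℚ ≤ q - p → p ≤ q
  0≤q-p⇒p≤q {p} {q} 0≤q-p = begin
    p          ≡⟨ +-identityˡ p ⟨
    0ℚ + p     ≤⟨ +-monoˡ-≤ p 0≤q-p ⟩
    q - p + p  ≡⟨ solve 2 (λ q p → q :- p :+ p := q) refl q p ⟩
    q          ∎
    where open ≤-Reasoning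

  *-nonNeg : ∀ {p q} → 0ℚ ≤ p → 0ℚ ≤ q → 0ℚ ≤ p * q
  *-nonNeg {p} {q} 0≤p 0≤q =
    nonNegative⁻¹ (p * q) {{nonNeg*nonNeg⇒nonNeg p {{nonNegative 0≤p}} q {{nonNegative 0≤q}}}}

  p≤∣p∣ : ∀ p → p ≤ abs p
  p≤∣p∣ p with ≤-total 0ℚ p
  ... | inj₁ 0≤p = ≤-reflexive (sym (0≤p⇒∣p∣≡p 0≤p))
  ... | inj₂ p≤0 = ≤-trans p≤0 (0≤∣p∣ p)

  ∣p-q∣≡∣q-p∣ : ∀ p q → abs (p - q) ≡ abs (q - p)
  ∣p-q∣≡∣q-p∣ p q = begin
    abs (p - q)      ≡⟨ ∣-p∣≡∣p∣ (p - q) ⟨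
    abs (- (p - q))  ≡⟨ cong abs (solve 2 (λ p q → :- (p :- q) := q :- p) refl p q) ⟩
    abs (q - p)      ∎
    where open ≡-Reasoning

  γ*p≤∣p∣ : ∀ {γ} → 0ℚ ≤ γ → γ ≤ 1ℚ → ∀ p → γ * p ≤ abs p
  γ*p≤∣p∣ {γ} 0≤γ γ≤1 p = begin
    γ * p          ≤⟨ p≤∣p∣ (γ * p) ⟩
    abs (γ * p)    ≡⟨ ∣p*q∣≡∣p∣*∣q∣ γ p ⟩
    abs γ * abs p  ≡⟨ cong (_* abs p) (0≤p⇒∣p∣≡p 0≤γ) ⟩
    γ * abs p      ≤⟨ *-monoʳ-≤-nonNeg (abs p) {{∣-∣-nonNeg p}} γ≤1 ⟩
    1ℚ * abs p     ≡⟨ *-identityˡ (abs p) ⟩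
    abs p          ∎
    where open ≤-Reasoning

  ¼ : ℚ
  ¼ = + 1 / 4

  0≤p⇒0≤p*¼ : ∀ {p} → 0ℚ ≤ p → 0ℚ ≤ p * ¼
  0≤p⇒0≤p*¼ 0≤p = *-nonNeg 0≤p (*≤* (ℤ.+≤+ ℕ.z≤n))

  p≤2⇒p*¼≤1 : ∀ {p} → p ≤ ℕ→ℚ 2 → p * ¼ ≤ 1ℚ
  p≤2⇒p*¼≤1 p≤2 = ≤-trans (*-monoʳ-≤-nonNeg ¼ p≤2) (*≤* (ℤ.+≤+ (ℕ.s≤s ℕ.z≤n)))

  -- a - b - ε/4 (a + b) is a nonnegative combination of a - (1 + ε) b and b.
  ratio-gap : ∀ {ε a b} → 0ℚ ≤ ε → ε ≤ ℕ→ℚ 2 → 0ℚ ≤ b → (1ℚ + ε) * b ≤ a →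
              ε * ¼ * (a + b) ≤ a - b
  ratio-gap {ε} {a} {b} 0≤ε ε≤2 0≤b b≤a = 0≤q-p⇒p≤q (begin
    0ℚ
      ≤⟨ +-mono-≤ first second ⟩
    (1ℚ - ε * ¼) * (a - (1ℚ + ε) * b) + ε * ¼ * (ℕ→ℚ 2 - ε) * b
      ≡⟨ solve 3 (λ ε a b → (con 1ℚ :- ε :* con ¼) :* (a :- (con 1ℚ :+ ε) :* b)
                              :+ ε :* con ¼ :* (con (ℕ→ℚ 2) :- ε) :* b
                          := a :- b :- ε :* con ¼ :* (a :+ b)) refl ε a b ⟩
    a - b - ε * ¼ * (a + b)
      ∎)
    where
    open ≤-Reasoning
    first : 0ℚ ≤ (1ℚ - ε * ¼) * (a - (1ℚ + ε) * b)
    first = *-nonNeg (p≤q⇒0≤q-p (p≤2⇒p*¼≤1 ε≤2)) (p≤q⇒0≤q-p b≤a)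
    second : 0ℚ ≤ ε * ¼ * (ℕ→ℚ 2 - ε) * b
    second = *-nonNeg (*-nonNeg (0≤p⇒0≤p*¼ 0≤ε) (p≤q⇒0≤q-p ε≤2)) 0≤b

  toℚᵘ-ℕ→ℚ : ∀ a → toℚᵘ (ℕ→ℚ a) ℚᵘ.≃ ℚᵘ.mkℚᵘ (+ a) 0
  toℚᵘ-ℕ→ℚ a = toℚᵘ-fromℚᵘ (ℚᵘ.mkℚᵘ (+ a) 0)

  toℚᵘ-inv : ∀ m → toℚᵘ (inv (suc m)) ℚᵘ.≃ ℚᵘ.mkℚᵘ (+ 1) m
  toℚᵘ-inv m = toℚᵘ-fromℚᵘ (ℚᵘ.mkℚᵘ (+ 1) m)

  ℕ→ℚ-nonNeg : ∀ a → 0ℚ ≤ ℕ→ℚ a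
  ℕ→ℚ-nonNeg a = nonNegative⁻¹ (ℕ→ℚ a) {{normalize-nonNeg a 1}}

  ℕ→ℚ-pos : ∀ a .{{_ : ℕ.NonZero a}} → 0ℚ < ℕ→ℚ a
  ℕ→ℚ-pos (suc a) = positive⁻¹ (ℕ→ℚ (suc a)) {{normalize-pos (suc a) 1}}

  inv-nonNeg : ∀ m → 0ℚ ≤ inv m
  inv-nonNeg zero    = ≤-refl
  inv-nonNeg (suc m) = nonNegative⁻¹ (inv (suc m)) {{normalize-nonNeg 1 (suc m)}}

  ℕ→ℚ-suc : ∀ a → ℕ→ℚ (suc a) ≡ 1ℚ + ℕ→ℚ a
  ℕ→ℚ-suc a = toℚᵘ-injective (begin
    toℚᵘ (ℕ→ℚ (suc a))           ≈⟨ toℚᵘ-ℕ→ℚ (suc a) ⟩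
    ℚᵘ.mkℚᵘ (+ suc a) 0           ≈⟨ ℚᵘ.*≡* (ring (+ a)) ⟩
    ℚᵘ.1ℚᵘ ℚᵘ.+ ℚᵘ.mkℚᵘ (+ a) 0  ≈⟨ ℚᵘ.+-congʳ ℚᵘ.1ℚᵘ (toℚᵘ-ℕ→ℚ a) ⟨
    toℚᵘ 1ℚ ℚᵘ.+ toℚᵘ (ℕ→ℚ a)    ≈⟨ toℚᵘ-homo-+ 1ℚ (ℕ→ℚ a) ⟨
    toℚᵘ (1ℚ + ℕ→ℚ a)             ∎)
    where
    open ℚᵘ.≃-Reasoning
    ring : ∀ (x : ℤ.ℤ) → (+ 1 ℤ.+ x) ℤ.* (+ 1 ℤ.* + 1) ≡ (+ 1 ℤ.* + 1 ℤ.+ x ℤ.* + 1) ℤ.* + 1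
    ring = ℤSolver.solve-∀

  ℕ→ℚ*inv[m*n]≡inv[m] : ∀ m n .{{_ : ℕ.NonZero n}} → ℕ→ℚ n * inv (m ℕ.* n) ≡ inv m
  ℕ→ℚ*inv[m*n]≡inv[m] zero    (suc s) = *-zeroʳ (ℕ→ℚ (suc s))
  ℕ→ℚ*inv[m*n]≡inv[m] (suc m) (suc s) = toℚᵘ-injective (begin
    toℚᵘ (ℕ→ℚ (suc s) * inv (suc m ℕ.* suc s))
      ≈⟨ toℚᵘ-homo-* (ℕ→ℚ (suc s)) (inv (suc m ℕ.* suc s)) ⟩
    toℚᵘ (ℕ→ℚ (suc s)) ℚᵘ.* toℚᵘ (inv (suc m ℕ.* suc s))
      ≈⟨ ℚᵘ.*-cong (toℚᵘ-ℕ→ℚ (suc s)) (toℚᵘ-inv (s ℕ.+ m ℕ.* suc s)) ⟩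
    ℚᵘ.mkℚᵘ (+ suc s) 0 ℚᵘ.* ℚᵘ.mkℚᵘ (+ 1) (s ℕ.+ m ℕ.* suc s)
      ≈⟨ ℚᵘ.*≡* (cong (λ z → + suc z) (ring m s)) ⟩
    ℚᵘ.mkℚᵘ (+ 1) m
      ≈⟨ toℚᵘ-inv m ⟨
    toℚᵘ (inv (suc m))
      ∎)
    where
    open ℚᵘ.≃-Reasoning
    ring : ∀ m s → m ℕ.+ s ℕ.* 1 ℕ.* suc m ≡ s ℕ.+ m ℕ.* suc s ℕ.+ 0 ℕ.+ 0
    ring = ℕSolver.solve-∀

  inv<ℕ→ℚ*inv : ∀ a {d m} .{{_ : ℕ.NonZero d}} .{{_ : ℕ.NonZero m}} →
                m ℕ.< d ℕ.* a → inv d < ℕ→ℚ a * inv m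
  inv<ℕ→ℚ*inv a {suc d} {suc m} m<da = toℚᵘ-cancel-< (begin-strict
    toℚᵘ (inv (suc d))                     ≃⟨ toℚᵘ-inv d ⟩
    ℚᵘ.mkℚᵘ (+ 1) d                        <⟨ ℚᵘ.*<* (subst₂ ℤ._<_ lhs rhs (ℤ.+<+ m<da)) ⟩
    ℚᵘ.mkℚᵘ (+ a) 0 ℚᵘ.* ℚᵘ.mkℚᵘ (+ 1) m   ≃⟨ ℚᵘ.*-cong (toℚᵘ-ℕ→ℚ a) (toℚᵘ-inv m) ⟨
    toℚᵘ (ℕ→ℚ a) ℚᵘ.* toℚᵘ (inv (suc m))   ≃⟨ toℚᵘ-homo-* (ℕ→ℚ a) (inv (suc m)) ⟨
    toℚᵘ (ℕ→ℚ a * inv (suc m))             ∎)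
    where
    open ℚᵘ.≤-Reasoning
    lhs : + suc m ≡ + suc (m ℕ.+ 0 ℕ.+ 0)
    lhs = cong (λ z → + suc z) (sym (trans (ℕ.+-identityʳ _) (ℕ.+-identityʳ m)))
    rhs : + (suc d ℕ.* a) ≡ (+ a ℤ.* + 1) ℤ.* + suc d
    rhs = trans (ℤ.pos-* (suc d) a)
                (trans (ℤ.*-comm (+ suc d) (+ a)) (cong (ℤ._* + suc d) (sym (ℤ.*-identityʳ (+ a)))))

  Σ≡sum : ∀ k (f : Fin k → ℚ) → Σ k f ≡ sum f
  Σ≡sum zero    f = refl
  Σ≡sum (suc k) f = cong (λ s → f zero + s) (Σ≡sum k (λ i → f (suc i)))

  Σ-cong : ∀ k {f g : Fin k → ℚ} → (∀ i → f i ≡ g i) → Σ k f ≡ Σ k g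
  Σ-cong zero    f≗g = refl
  Σ-cong (suc k) f≗g = cong₂ _+_ (f≗g zero) (Σ-cong k (λ i → f≗g (suc i)))

  Σ-mono-≤ : ∀ k {f g : Fin k → ℚ} → (∀ i → f i ≤ g i) → Σ k f ≤ Σ k g
  Σ-mono-≤ zero    f≤g = ≤-refl
  Σ-mono-≤ (suc k) f≤g = +-mono-≤ (f≤g zero) (Σ-mono-≤ k (λ i → f≤g (suc i)))

  Σ-zero : ∀ k → Σ k (λ _ → 0ℚ) ≡ 0ℚ
  Σ-zero zero    = refl
  Σ-zero (suc k) = trans (+-identityˡ _) (Σ-zero k)

  Σ-distrib-- : ∀ k (f g : Fin k → ℚ) → Σ k (λ i → f i - g i) ≡ Σ k f - Σ k g
  Σ-distrib-- zero    f g = refl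
  Σ-distrib-- (suc k) f g = begin
    f₀ - g₀ + Σ k (λ i → f (suc i) - g (suc i))
      ≡⟨ cong (λ s → f₀ - g₀ + s) (Σ-distrib-- k f′ g′) ⟩
    f₀ - g₀ + (Σ k f′ - Σ k g′)
      ≡⟨ solve 4 (λ a b c d → a :- b :+ (c :- d) := a :+ c :- (b :+ d)) refl f₀ g₀ (Σ k f′) (Σ k g′) ⟩
    f₀ + Σ k f′ - (g₀ + Σ k g′)
      ∎
    where
    open ≡-Reasoning
    f₀ g₀ : ℚ
    f₀ = f zero
    g₀ = g zero
    f′ g′ : Fin k → ℚ
    f′ i = f (suc i)
    g′ i = g (suc i)

  Σ-comm : ∀ k n (f : Fin k → Fin n → ℚ) → Σ k (λ i → Σ n (f i)) ≡ Σ n (λ j → Σ k (λ i → f i j))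
  Σ-comm k n f = begin
    Σ k (λ i → Σ n (f i))          ≡⟨ Σ-cong k (λ i → Σ≡sum n (f i)) ⟩
    Σ k (λ i → sum (f i))          ≡⟨ Σ≡sum k _ ⟩
    sum (λ i → sum (f i))          ≡⟨ ∑-comm f ⟩
    sum (λ j → sum (λ i → f i j))  ≡⟨ Σ≡sum n _ ⟨
    Σ n (λ j → sum (λ i → f i j))  ≡⟨ Σ-cong n (λ j → Σ≡sum k (λ i → f i j)) ⟨
    Σ n (λ j → Σ k (λ i → f i j))  ∎
    where open ≡-Reasoning

  Σ-permute : ∀ n (f : Fin n → ℚ) (π : Permutation′ n) → Σ n f ≡ Σ n (λ x → f (π ⟨$⟩ʳ x))
  Σ-permute n f π = begin
    Σ n f                     ≡⟨ Σ≡sum n f ⟩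
    sum f                     ≡⟨ ∑-permute f π ⟩
    sum (λ x → f (π ⟨$⟩ʳ x))  ≡⟨ Σ≡sum n _ ⟨
    Σ n (λ x → f (π ⟨$⟩ʳ x))  ∎
    where open ≡-Reasoning

  Σ-single : ∀ k (f : Fin k → ℚ) c → (∀ i → i ≢ c → f i ≡ 0ℚ) → Σ k f ≡ f c
  Σ-single (suc k) f zero    f≡0 = begin
    f zero + Σ k (λ i → f (suc i))  ≡⟨ cong (λ s → f zero + s) (Σ-cong k (λ i → f≡0 (suc i) λ ())) ⟩
    f zero + Σ k (λ _ → 0ℚ)         ≡⟨ cong (λ s → f zero + s) (Σ-zero k) ⟩
    f zero + 0ℚ                     ≡⟨ +-identityʳ (f zero) ⟩
    f zero                          ∎
    where open ≡-Reasoning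
  Σ-single (suc k) f (suc c) f≡0 = begin
    f zero + Σ k (λ i → f (suc i))  ≡⟨ cong (_+ Σ k (λ i → f (suc i))) (f≡0 zero λ ()) ⟩
    0ℚ + Σ k (λ i → f (suc i))      ≡⟨ +-identityˡ _ ⟩
    Σ k (λ i → f (suc i))           ≡⟨ Σ-single k (λ i → f (suc i)) c
                                         (λ i i≢c → f≡0 (suc i) (i≢c ∘ Fin.suc-injective)) ⟩
    f (suc c)                       ∎
    where open ≡-Reasoning

  mask : ∀ {k} → Subset k → (Fin k → ℚ) → Fin k → ℚ
  mask I f i = if does (i ∈? I) then f i else 0ℚ

  mask-∈ : ∀ {k} {I : Subset k} {i} (f : Fin k → ℚ) → i ∈ I → mask I f i ≡ f i
  mask-∈ {I = I} {i} f i∈I rewrite dec-true (i ∈? I) i∈I = refl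

  mask-∉ : ∀ {k} {I : Subset k} {i} (f : Fin k → ℚ) → i ∉ I → mask I f i ≡ 0ℚ
  mask-∉ {I = I} {i} f i∉I rewrite dec-false (i ∈? I) i∉I = refl

  mask-cong : ∀ {k} (I : Subset k) {f g : Fin k → ℚ} {i} → f i ≡ g i → mask I f i ≡ mask I g i
  mask-cong I {i = i} = cong (λ v → if does (i ∈? I) then v else 0ℚ)

  mask-zero : ∀ {k} (I : Subset k) {f : Fin k → ℚ} {i} → f i ≡ 0ℚ → mask I f i ≡ 0ℚ
  mask-zero I {i = i} fi≡0 with does (i ∈? I)
  ... | true  = fi≡0
  ... | false = refl

  Σ-mask-const : ∀ {n} (p : Subset n) v → Σ n (mask p (λ _ → v)) ≡ ℕ→ℚ ∣ p ∣ * v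
  Σ-mask-const []            v = sym (*-zeroˡ v)
  Σ-mask-const (outside ∷ p) v = trans (+-identityˡ _) (Σ-mask-const p v)
  Σ-mask-const (inside  ∷ p) v = begin
    v + Σ _ (mask p (λ _ → v))  ≡⟨ cong (λ s → v + s) (Σ-mask-const p v) ⟩
    v + ℕ→ℚ ∣ p ∣ * v           ≡⟨ solve 2 (λ v a → v :+ a :* v := (con 1ℚ :+ a) :* v) refl v (ℕ→ℚ ∣ p ∣) ⟩
    (1ℚ + ℕ→ℚ ∣ p ∣) * v        ≡⟨ cong (_* v) (ℕ→ℚ-suc ∣ p ∣) ⟨
    ℕ→ℚ (suc ∣ p ∣) * v         ∎
    where open ≡-Reasoning

  ∈?-△ : ∀ {k} (A B : Subset k) i → does (i ∈? A △ B) ≡ does (i ∈? A) xor does (i ∈? B)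
  ∈?-△ (inside  ∷ A) (inside  ∷ B) zero    = refl
  ∈?-△ (inside  ∷ A) (outside ∷ B) zero    = refl
  ∈?-△ (outside ∷ A) (inside  ∷ B) zero    = refl
  ∈?-△ (outside ∷ A) (outside ∷ B) zero    = refl
  ∈?-△ (a ∷ A)       (b ∷ B)       (suc i) = ∈?-△ A B i

  density : ∀ {k n} → (Fin k → Subset n) → ℕ → Fin k → ℚ
  density S m i = inv (m ℕ.* ∣ S i ∣)

  module _ {k n} {S : Fin k → Subset n} (P : IsNonEmptyPartition S) where
    open IsNonEmptyPartition P

    block : Fin n → Fin k
    block x = proj₁ (covers x)

    ∈-block : ∀ x → x ∈ S (block x)
    ∈-block x = proj₂ (covers x)

    ∣S∣-nonZero : ∀ i → ℕ.NonZero ∣ S i ∣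
    ∣S∣-nonZero i with nonempty i
    ... | x , x∈Si = ℕ.>-nonZero (ℕ.≤-<-trans ℕ.z≤n (Subset.x∈p⇒∣p-x∣<∣p∣ x∈Si))

    Σ-block : ∀ x (f : Fin k → ℚ) → (∀ i → x ∉ S i → f i ≡ 0ℚ) → Σ k f ≡ f (block x)
    Σ-block x f f≡0 = Σ-single k f (block x) λ i i≢bx →
      f≡0 i (λ x∈Si → disjoint i (block x) i≢bx x x∈Si (∈-block x))

    Σ-∘block : ∀ (h : Fin k → ℚ) → Σ n (λ x → h (block x)) ≡ Σ k (λ i → ℕ→ℚ ∣ S i ∣ * h i)
    Σ-∘block h = begin
      Σ n (λ x → h (block x))                           ≡⟨ Σ-cong n indicators ⟨
      Σ n (λ x → Σ k (λ i → mask (S i) (λ _ → h i) x))  ≡⟨ Σ-comm n k _ ⟩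
      Σ k (λ i → Σ n (mask (S i) (λ _ → h i)))          ≡⟨ Σ-cong k (λ i → Σ-mask-const (S i) (h i)) ⟩
      Σ k (λ i → ℕ→ℚ ∣ S i ∣ * h i)                     ∎
      where
      open ≡-Reasoning
      indicators : ∀ x → Σ k (λ i → mask (S i) (λ _ → h i) x) ≡ h (block x)
      indicators x = trans (Σ-block x (λ i → mask (S i) (λ _ → h i) x) (λ i → mask-∉ (λ _ → h i)))
                           (mask-∈ (λ _ → h (block x)) (∈-block x))

    chunk-block : ∀ I x → chunk S I x ≡ mask I (density S ∣ I ∣) (block x)
    chunk-block I x =
      trans (Σ-block x (mask I inner) (λ i x∉Si → mask-zero I {inner} (mask-∉ (λ _ → V i) x∉Si)))
            (mask-cong I {inner} {V} (mask-∈ (λ _ → V (block x)) (∈-block x)))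
      where
      V inner : Fin k → ℚ
      V = density S ∣ I ∣
      inner i = mask (S i) (λ _ → V i) x

    Σ-weighted-chunk : ∀ (w : Fin k → ℚ) I →
      Σ n (λ x → w (block x) * chunk S I x) ≡ Σ k (λ i → w i * mask I (λ _ → inv ∣ I ∣) i)
    Σ-weighted-chunk w I = begin
      Σ n (λ x → w (block x) * chunk S I x)
        ≡⟨ Σ-cong n (λ x → cong (w (block x) *_) (chunk-block I x)) ⟩
      Σ n (λ x → w (block x) * mask I V (block x))
        ≡⟨ Σ-∘block (λ i → w i * mask I V i) ⟩
      Σ k (λ i → ℕ→ℚ ∣ S i ∣ * (w i * mask I V i))
        ≡⟨ Σ-cong k (λ i → trans (solve 3 (λ s w v → s :* (w :* v) := w :* (s :* v))
                                           refl (ℕ→ℚ ∣ S i ∣) (w i) (mask I V i))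
                                  (cong (w i *_) (mass i))) ⟩
      Σ k (λ i → w i * mask I (λ _ → inv ∣ I ∣) i)
        ∎
      where
      open ≡-Reasoning
      V : Fin k → ℚ
      V = density S ∣ I ∣
      mass : ∀ i → ℕ→ℚ ∣ S i ∣ * mask I V i ≡ mask I (λ _ → inv ∣ I ∣) i
      mass i with does (i ∈? I)
      ... | true  = ℕ→ℚ*inv[m*n]≡inv[m] ∣ I ∣ ∣ S i ∣ {{∣S∣-nonZero i}}
      ... | false = *-zeroʳ (ℕ→ℚ ∣ S i ∣)

  module _ {k n} {S : Fin k → Subset n} {ρ} (1≤ρ : 1ℚ ≤ ρ) (inc : IsIncreasing ρ S) where

    increasing⇒ρ*∣Sᵢ∣≤∣Sⱼ∣ : ∀ {i j} → toℕ i ℕ.< toℕ j → ρ * ℕ→ℚ ∣ S i ∣ ≤ ℕ→ℚ ∣ S j ∣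
    increasing⇒ρ*∣Sᵢ∣≤∣Sⱼ∣ {i} {j} i<j =
      go (toℕ j ℕ.∸ suc (toℕ i)) j (trans (sym (ℕ.m∸n+n≡m i<j)) (ℕ.+-suc _ (toℕ i)))
      where
      go : ∀ g j → toℕ j ≡ suc (g ℕ.+ toℕ i) → ρ * ℕ→ℚ ∣ S i ∣ ≤ ℕ→ℚ ∣ S j ∣
      go zero    j j≡ = inc i j j≡
      go (suc g) j j≡ = begin
        ρ * ℕ→ℚ ∣ S i ∣    ≤⟨ go g j′ (Fin.toℕ-fromℕ< j′<k) ⟩
        ℕ→ℚ ∣ S j′ ∣       ≡⟨ *-identityˡ _ ⟨
        1ℚ * ℕ→ℚ ∣ S j′ ∣  ≤⟨ *-monoʳ-≤-nonNeg (ℕ→ℚ ∣ S j′ ∣) {{nonNegative (ℕ→ℚ-nonNeg ∣ S j′ ∣)}} 1≤ρ ⟩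
        ρ * ℕ→ℚ ∣ S j′ ∣   ≤⟨ inc j′ j (trans j≡ (cong suc (sym (Fin.toℕ-fromℕ< j′<k)))) ⟩
        ℕ→ℚ ∣ S j ∣        ∎
        where
        open ≤-Reasoning
        j′<k : suc (g ℕ.+ toℕ i) ℕ.< k
        j′<k = ℕ.<-trans (ℕ.n<1+n _) (subst (ℕ._< k) j≡ (Fin.toℕ<n j))
        j′ : Fin k
        j′ = fromℕ< j′<k

  ρ*inv[m*t]≤inv[m*s] : ∀ {ρ} m {s t} .{{_ : ℕ.NonZero s}} .{{_ : ℕ.NonZero t}} →
                        ρ * ℕ→ℚ s ≤ ℕ→ℚ t → ρ * inv (m ℕ.* t) ≤ inv (m ℕ.* s)
  ρ*inv[m*t]≤inv[m*s] {ρ} m {s} {t} ρs≤t = *-cancelˡ-≤-pos (ℕ→ℚ s) {{positive (ℕ→ℚ-pos s)}} (begin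
    ℕ→ℚ s * (ρ * inv (m ℕ.* t))
      ≡⟨ solve 3 (λ s ρ v → s :* (ρ :* v) := ρ :* s :* v) refl (ℕ→ℚ s) ρ (inv (m ℕ.* t)) ⟩
    ρ * ℕ→ℚ s * inv (m ℕ.* t)
      ≤⟨ *-monoʳ-≤-nonNeg (inv (m ℕ.* t)) {{nonNegative (inv-nonNeg (m ℕ.* t))}} ρs≤t ⟩
    ℕ→ℚ t * inv (m ℕ.* t)
      ≡⟨ ℕ→ℚ*inv[m*n]≡inv[m] m t ⟩
    inv m
      ≡⟨ ℕ→ℚ*inv[m*n]≡inv[m] m s ⟨
    ℕ→ℚ s * inv (m ℕ.* s)
      ∎)
    where open ≤-Reasoning

  module _ {k n} {S : Fin k → Subset n} {ε} (0≤ε : 0ℚ ≤ ε) (ε≤2 : ε ≤ ℕ→ℚ 2)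
           (P : IsNonEmptyPartition S) (inc : IsIncreasing (1ℚ + ε) S) (m : ℕ) where

    density-gap-ordered : ∀ {i j} → toℕ i ℕ.< toℕ j →
      ε * ¼ * (density S m i + density S m j) ≤ abs (density S m i - density S m j)
    density-gap-ordered {i} {j} i<j =
      ≤-trans (ratio-gap 0≤ε ε≤2 (inv-nonNeg (m ℕ.* ∣ S j ∣)) ratio) (p≤∣p∣ (density S m i - density S m j))
      where
      1≤1+ε : 1ℚ ≤ 1ℚ + ε
      1≤1+ε = subst (_≤ 1ℚ + ε) (+-identityʳ 1ℚ) (+-monoʳ-≤ 1ℚ 0≤ε)
      ratio : (1ℚ + ε) * density S m j ≤ density S m i
      ratio = ρ*inv[m*t]≤inv[m*s] {1ℚ + ε} m {{∣S∣-nonZero P i}} {{∣S∣-nonZero P j}}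
                                  (increasing⇒ρ*∣Sᵢ∣≤∣Sⱼ∣ {S = S} 1≤1+ε inc i<j)

    density-gap : ∀ {c d} → c ≢ d →
      ε * ¼ * (density S m c + density S m d) ≤ abs (density S m c - density S m d)
    density-gap {c} {d} c≢d with ℕ.<-cmp (toℕ c) (toℕ d)
    ... | tri< c<d _ _ = density-gap-ordered c<d
    ... | tri≈ _ c≡d _ = ⊥-elim (c≢d (Fin.toℕ-injective c≡d))
    ... | tri> _ _ d<c = subst₂ _≤_ (cong (ε * ¼ *_) (+-comm (density S m d) (density S m c)))
                                    (∣p-q∣≡∣q-p∣ (density S m d) (density S m c))
                                    (density-gap-ordered d<c)

  weight : ∀ {k} → ℚ → Subset k → Subset k → Fin k → ℚ
  weight γ I₁ I₂ i = if does (i ∈? I₁) then γ else if does (i ∈? I₂) then - γ else γ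

  weight-mask-difference : ∀ {k} γ (I₁ I₂ : Subset k) u i →
    weight γ I₁ I₂ i * mask I₁ (λ _ → u) i - weight γ I₁ I₂ i * mask I₂ (λ _ → u) i
      ≡ mask (I₁ △ I₂) (λ _ → γ * u) i
  weight-mask-difference γ I₁ I₂ u i rewrite ∈?-△ I₁ I₂ i with does (i ∈? I₁) | does (i ∈? I₂)
  ... | true  | true  = solve 2 (λ g u → g :* u :- g :* u := con 0ℚ) refl γ u
  ... | true  | false = solve 2 (λ g u → g :* u :- g :* con 0ℚ := g :* u) refl γ u
  ... | false | true  = solve 2 (λ g u → :- g :* con 0ℚ :- :- g :* u := g :* u) refl γ u
  ... | false | false = solve 2 (λ g u → g :* con 0ℚ :- g :* con 0ℚ := con 0ℚ) refl γ u

  module _ {k γ} (0≤γ : 0ℚ ≤ γ) (γ≤1 : γ ≤ 1ℚ) {V : Fin k → ℚ}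
           (gap : ∀ {c d} → c ≢ d → γ * (V c + V d) ≤ abs (V c - V d)) (I₁ I₂ : Subset k) where

    weight-on-I₁ : ∀ c → weight γ I₁ I₂ c * mask I₁ V c ≡ γ * mask I₁ V c
    weight-on-I₁ c with does (c ∈? I₁)
    ... | true  = refl
    ... | false = trans (*-zeroʳ (if does (c ∈? I₂) then - γ else γ)) (sym (*-zeroʳ γ))

    γ*p-γ*q≤∣p-q∣ : ∀ p q → γ * p - γ * q ≤ abs (p - q)
    γ*p-γ*q≤∣p-q∣ p q = subst (_≤ abs (p - q))
                              (solve 3 (λ g p q → g :* (p :- q) := g :* p :- g :* q) refl γ p q)
                              (γ*p≤∣p∣ 0≤γ γ≤1 (p - q))

    γ*[0+q]≤∣0-q∣ : ∀ q → γ * (0ℚ + q) ≤ abs (0ℚ - q)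
    γ*[0+q]≤∣0-q∣ q = begin
      γ * (0ℚ + q)  ≡⟨ cong (γ *_) (+-identityˡ q) ⟩
      γ * q         ≤⟨ γ*p≤∣p∣ 0≤γ γ≤1 q ⟩
      abs q         ≡⟨ ∣-p∣≡∣p∣ q ⟨
      abs (- q)     ≡⟨ cong abs (+-identityˡ (- q)) ⟨
      abs (0ℚ - q)  ∎
      where open ≤-Reasoning

    opposite-weights : ∀ c {d} → d ∉ I₁ → γ * (mask I₁ V c + V d) ≤ abs (mask I₁ V c - V d)
    opposite-weights c {d} d∉I₁ with c ∈? I₁
    ... | yes c∈I₁ = gap (λ c≡d → d∉I₁ (subst (_∈ I₁) c≡d c∈I₁))
    ... | no  _    = γ*[0+q]≤∣0-q∣ (V d)

    weighted-mask-≤ : ∀ c d → weight γ I₁ I₂ c * mask I₁ V c - weight γ I₁ I₂ d * mask I₂ V d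
                                ≤ abs (mask I₁ V c - mask I₂ V d)
    weighted-mask-≤ c d rewrite weight-on-I₁ c with d ∈? I₁ | d ∈? I₂
    ... | yes _    | _     = γ*p-γ*q≤∣p-q∣ _ _
    ... | no  _    | no  _ = γ*p-γ*q≤∣p-q∣ _ _
    ... | no  d∉I₁ | yes _ =
      subst (_≤ abs (mask I₁ V c - V d))
            (solve 3 (λ g a b → g :* (a :+ b) := g :* a :- (:- g) :* b) refl γ (mask I₁ V c) (V d))
            (opposite-weights c d∉I₁)

  test-function-bound : ∀ {n} (π : Permutation′ n) {f g μ ν : Fin n → ℚ} →
    (∀ x y → f x - g y ≤ abs (μ x - ν y)) → Σ n f - Σ n g ≤ Σ n (λ x → abs (μ x - permDist π ν x))
  test-function-bound {n} π {f} {g} {μ} {ν} f-g≤ = begin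
    Σ n f - Σ n g                           ≡⟨ cong (λ s → Σ n f - s) (Σ-permute n g π) ⟩
    Σ n f - Σ n (λ x → g (π ⟨$⟩ʳ x))        ≡⟨ Σ-distrib-- n f (λ x → g (π ⟨$⟩ʳ x)) ⟨
    Σ n (λ x → f x - g (π ⟨$⟩ʳ x))          ≤⟨ Σ-mono-≤ n (λ x → f-g≤ x (π ⟨$⟩ʳ x)) ⟩
    Σ n (λ x → abs (μ x - permDist π ν x))  ∎
    where open ≤-Reasoning

  module _ {k n} {S : Fin k → Subset n} {ε} (0≤ε : 0ℚ ≤ ε) (ε≤2 : ε ≤ ℕ→ℚ 2)
           (P : IsNonEmptyPartition S) (inc : IsIncreasing (1ℚ + ε) S)
           {I₁ I₂ : Subset k} (∣I₁∣≡∣I₂∣ : ∣ I₁ ∣ ≡ ∣ I₂ ∣) (π : Permutation′ n) where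

    chunk-distance-lowerBound : ℕ→ℚ ∣ I₁ △ I₂ ∣ * (ε * ¼ * inv ∣ I₁ ∣)
                                  ≤ Σ n (λ x → abs (chunk S I₁ x - permDist π (chunk S I₂) x))
    chunk-distance-lowerBound = begin
      ℕ→ℚ ∣ I₁ △ I₂ ∣ * (γ * u)
        ≡⟨ Σ-mask-const (I₁ △ I₂) (γ * u) ⟨
      Σ k (mask (I₁ △ I₂) (λ _ → γ * u))
        ≡⟨ Σ-cong k (weight-mask-difference γ I₁ I₂ u) ⟨
      Σ k (λ i → w i * mask I₁ (λ _ → u) i - w i * mask I₂ (λ _ → u) i)
        ≡⟨ Σ-distrib-- k (λ i → w i * mask I₁ (λ _ → u) i) (λ i → w i * mask I₂ (λ _ → u) i) ⟩
      Σ k (λ i → w i * mask I₁ (λ _ → u) i) - Σ k (λ i → w i * mask I₂ (λ _ → u) i)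
        ≡⟨ cong₂ _-_ (Σ-weighted-chunk P w I₁) Σ-weighted-chunk₂ ⟨
      Σ n (λ x → w (block P x) * chunk S I₁ x) - Σ n (λ y → w (block P y) * chunk S I₂ y)
        ≤⟨ test-function-bound π {μ = chunk S I₁} {ν = chunk S I₂} pointwise ⟩
      Σ n (λ x → abs (chunk S I₁ x - permDist π (chunk S I₂) x))
        ∎
      where
      open ≤-Reasoning
      γ u : ℚ
      γ = ε * ¼
      u = inv ∣ I₁ ∣
      w V : Fin k → ℚ
      w = weight γ I₁ I₂
      V = density S ∣ I₁ ∣

      Σ-weighted-chunk₂ : Σ n (λ y → w (block P y) * chunk S I₂ y) ≡ Σ k (λ i → w i * mask I₂ (λ _ → u) i)
      Σ-weighted-chunk₂ = trans (Σ-weighted-chunk P w I₂)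
                                (cong (λ m → Σ k (λ i → w i * mask I₂ (λ _ → inv m) i)) (sym ∣I₁∣≡∣I₂∣))

      chunk₂-block : ∀ y → chunk S I₂ y ≡ mask I₂ V (block P y)
      chunk₂-block y = trans (chunk-block P I₂ y)
                             (cong (λ m → mask I₂ (density S m) (block P y)) (sym ∣I₁∣≡∣I₂∣))

      pointwise : ∀ x y → w (block P x) * chunk S I₁ x - w (block P y) * chunk S I₂ y
                            ≤ abs (chunk S I₁ x - chunk S I₂ y)
      pointwise x y rewrite chunk-block P I₁ x | chunk₂-block y =
        weighted-mask-≤ (0≤p⇒0≤p*¼ 0≤ε) (p≤2⇒p*¼≤1 ε≤2) {V} (density-gap 0≤ε ε≤2 P inc ∣ I₁ ∣) I₁ I₂
                        (block P x) (block P y)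

  chunk-dTV>ε/120 : ∀ {k n} {S : Fin k → Subset n} {ε} → 0ℚ < ε → ε ≤ 1ℚ →
    IsNonEmptyPartition S → IsIncreasing (1ℚ + ε) S →
    ∀ {I₁ I₂ : Subset k} → ∣ I₁ ∣ ≡ ∣ I₂ ∣ → .{{_ : ℕ.NonZero ∣ I₁ ∣}} → ∣ I₁ ∣ ℕ.< 15 ℕ.* ∣ I₁ △ I₂ ∣ →
    (π : Permutation′ n) → + 1 / 120 * ε < dTV (chunk S I₁) (permDist π (chunk S I₂))
  chunk-dTV>ε/120 {S = S} {ε} 0<ε ε≤1 P inc {I₁} {I₂} ∣I₁∣≡∣I₂∣ ∣I₁∣<15∣Δ∣ π = begin-strict
    + 1 / 120 * ε
      ≡⟨ solve 1 (λ e → con (+ 1 / 120) :* e := con ½ :* (e :* con ¼ :* con (inv 15))) refl ε ⟩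
    ½ * (ε * ¼ * inv 15)
      <⟨ *-monoʳ-<-pos ½ (*-monoʳ-<-pos (ε * ¼) {{ε¼-pos}} (inv<ℕ→ℚ*inv Δ {15} {∣ I₁ ∣} ∣I₁∣<15∣Δ∣)) ⟩
    ½ * (ε * ¼ * (ℕ→ℚ Δ * inv ∣ I₁ ∣))
      ≡⟨ cong (½ *_) (solve 3 (λ e d u → e :* con ¼ :* (d :* u) := d :* (e :* con ¼ :* u))
                              refl ε (ℕ→ℚ Δ) (inv ∣ I₁ ∣)) ⟩
    ½ * (ℕ→ℚ Δ * (ε * ¼ * inv ∣ I₁ ∣))
      ≤⟨ *-monoˡ-≤-nonNeg ½ (chunk-distance-lowerBound (<⇒≤ 0<ε) (≤-trans ε≤1 1≤2) P inc ∣I₁∣≡∣I₂∣ π) ⟩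
    dTV (chunk S I₁) (permDist π (chunk S I₂))
      ∎
    where
    open ≤-Reasoning
    Δ : ℕ
    Δ = ∣ I₁ △ I₂ ∣
    ε¼-pos : Positive (ε * ¼)
    ε¼-pos = pos*pos⇒pos ε {{positive 0<ε}} ¼
    1≤2 : 1ℚ ≤ ℕ→ℚ 2
    1≤2 = *≤* (ℤ.+≤+ (ℕ.s≤s ℕ.z≤n))

open import Data.Nat using (ℕ; _*_)
import Data.Nat
import Data.Nat.Properties as ℕ
import Data.Fin.Subset.Properties as Subset
import Data.Rational
open import Data.Integer using (+_)
open import Data.Rational using (ℚ; 0ℚ; 1ℚ; _+_; _/_; _<_; _≤_)

lemma10p47 : (ε : ℚ) → 0ℚ < ε → ε ≤ 1ℚ →
    (k n : ℕ) (S : Fin k → Subset n) → IsNonEmptyPartition S → IsIncreasing (1ℚ + ε) S →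
    (I₁ I₂ : Subset k) → 2 * ∣ I₁ ∣ ≡ k → 2 * ∣ I₂ ∣ ≡ k →
    Data.Nat._<_ k (30 * ∣ I₁ △ I₂ ∣) →
    (π : Permutation′ n) →
    Data.Rational._*_ (+ 1 / 120) ε < dTV (chunk S I₁) (permDist π (chunk S I₂))
lemma10p47 ε 0<ε ε≤1 k n S P inc I₁ I₂ 2∣I₁∣≡k 2∣I₂∣≡k k<30∣Δ∣ π =
  chunk-dTV>ε/120 0<ε ε≤1 P inc ∣I₁∣≡∣I₂∣ {{∣I₁∣≢0}} ∣I₁∣<15∣Δ∣ π
  where
  ∣I₁∣≡∣I₂∣ : ∣ I₁ ∣ ≡ ∣ I₂ ∣
  ∣I₁∣≡∣I₂∣ = ℕ.*-cancelˡ-≡ ∣ I₁ ∣ ∣ I₂ ∣ 2 (trans 2∣I₁∣≡k (sym 2∣I₂∣≡k))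
  ∣I₁∣<15∣Δ∣ : Data.Nat._<_ ∣ I₁ ∣ (15 * ∣ I₁ △ I₂ ∣)
  ∣I₁∣<15∣Δ∣ = ℕ.*-cancelˡ-< 2 ∣ I₁ ∣ (15 * ∣ I₁ △ I₂ ∣)
                 (subst₂ Data.Nat._<_ (sym 2∣I₁∣≡k) (ℕ.*-assoc 2 15 ∣ I₁ △ I₂ ∣) k<30∣Δ∣)
  0<30k : Data.Nat._<_ 0 (30 * k)
  0<30k = ℕ.<-≤-trans (ℕ.≤-<-trans Data.Nat.z≤n k<30∣Δ∣) (ℕ.*-monoʳ-≤ 30 (Subset.∣p∣≤n (I₁ △ I₂)))
  k≢0 : Data.Nat.NonZero k
  k≢0 = ℕ.m*n≢0⇒n≢0 30 {{Data.Nat.>-nonZero 0<30k}}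
  ∣I₁∣≢0 : Data.Nat.NonZero ∣ I₁ ∣
  ∣I₁∣≢0 = ℕ.m*n≢0⇒n≢0 2 {{subst Data.Nat.NonZero (sym 2∣I₁∣≡k) k≢0}}
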